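{- Let $\mathbf{A}=(A,\circ)$ be a linear quasigroup with arithmetic form $(A,+,\varphi_0,\varphi_1,0)$ (so $x\circ y=\varphi_0(x)+\varphi_1(y)$ with $(A,+)$ a group and $\varphi_0,\varphi_1\in\mathrm{Aut}(A,+)$). Let $t,t'\in B_n$ with corresponding binary trees $T,T'\in\mathcal{T}_n$. (i) If $\varphi_0=\varphi_1$ and $\varphi_0$ has order $k$, then $\mathbf{A}$ satisfies $t\approx t'$ iff $T\equiv^D_kT'$; consequently $s_n(\mathbf{A})=|\mathcal{T}_n/{\equiv^D_k}|$. (ii) If $\varphi_1=\mathrm{id}_A$ and $\varphi_0$ has order $k$, then $\mathbf{A}$ satisfies $t\approx t'$ iff $T\equiv^L_kT'$; consequently $s_n(\mathbf{A})=|\mathcal{T}_n/{\equiv^L_k}|$. (iii) If $\varphi_0=\mathrm{id}_A$ and $\varphi_1$ has order $k$, then $\mathbf{A}$ satisfies $t\approx t'$ iff $T\equiv^R_kT'$; consequently $s_n(\mathbf{A})=|\mathcal{T}_n/{\equiv^R_k}|$.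
   Context: A bracketing of size $n$ is a fully parenthesised product of $x_1,\dots,x_n$ in this order; $B_n$ is their set. $\mathcal{T}_n$ is the set of binary trees (rooted plane trees, each internal vertex with ordered left and right child) with $n$ leaves, numbered $1,\dots,n$ left to right; a bracketing corresponds to the tree $\tau(t)$ with $\tau(x_i)$ the one-vertex tree and $\tau((t_1t_2))$ the tree whose root has left subtree $\tau(t_1)$ and right subtree $\tau(t_2)$. For a leaf $i$, $\mathrm{ld}_T(i)$, $\mathrm{rd}_T(i)$, $d_T(i)$ are the numbers of left steps, right steps, and all steps on the path from the root to $i$. For $k\in\mathbb{N}_+$: $T\equiv^D_kT'$ iff $d_T(i)\equiv d_{T'}(i)\pmod k$ for all $i$; $T\equiv^L_kT'$ iff $\mathrm{ld}_T(i)\equiv\mathrm{ld}_{T'}(i)\pmod k$ for all $i$; $T\equiv^R_kT'$ iff $\mathrm{rd}_T(i)\equiv\mathrm{rd}_{T'}(i)\pmod k$ for all $i$. $s_n(\mathbf{A})$ is the number of distinct term operations of $\mathbf{A}$ induced by bracketings of size $n$. -}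

module Defs where

open import Level using (Level; _⊔_)
open import Data.Nat using (ℕ; zero; suc; _+_; _<_)
open import Data.Fin using (Fin; splitAt; _↑ˡ_; _↑ʳ_)
import Data.Fin as Fin
open import Data.Sum using (_⊎_; inj₁; inj₂)
open import Data.Product using (Σ; ∃; _×_)
open import Data.Integer as ℤ using (ℤ; +_; _-_)
open import Data.Integer.Divisibility using (_∣_)
open import Relation.Binary.PropositionalEquality using (_≡_)
open import Relation.Nullary using (¬_)
open import Algebra.Bundles using (Group)
open import Algebra.Morphism.Structures using (module GroupMorphisms)

-- Bracketings of size n: fully parenthesised products of x₁,…,xₙ
-- (in this order).  The variables are implicit: the i-th leaf is xᵢ.

data Bracketing : ℕ → Set where
  x   : Bracketing 1
  [_·_] : ∀ {m k} → Bracketing m → Bracketing k → Bracketing (m + k)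

-- Binary trees (rooted plane trees, ordered left/right children)
-- with n leaves, leaves numbered 0,…,n-1 left to right (Fin n).

data Tree : ℕ → Set where
  leaf : Tree 1
  node : ∀ {m k} → Tree m → Tree k → Tree (m + k)

τ : ∀ {n} → Bracketing n → Tree n
τ x         = leaf
τ [ t₁ · t₂ ] = node (τ t₁) (τ t₂)

ld : ∀ {n} → Tree n → Fin n → ℕ
ld leaf i = 0
ld (node {m} {k} l r) i with splitAt m i
... | inj₁ j = suc (ld l j)
... | inj₂ j = ld r j

rd : ∀ {n} → Tree n → Fin n → ℕ
rd leaf i = 0
rd (node {m} {k} l r) i with splitAt m i
... | inj₁ j = rd l j
... | inj₂ j = suc (rd r j)

d : ∀ {n} → Tree n → Fin n → ℕ
d leaf i = 0
d (node {m} {k} l r) i with splitAt m i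
... | inj₁ j = suc (d l j)
... | inj₂ j = suc (d r j)

_≡_[mod_] : ℕ → ℕ → ℕ → Set
a ≡ b [mod k ] = + k ∣ (+ a - + b)

_≡D[_]_ : ∀ {n} → Tree n → ℕ → Tree n → Set
T ≡D[ k ] T' = ∀ i → d T i ≡ d T' i [mod k ]

_≡L[_]_ : ∀ {n} → Tree n → ℕ → Tree n → Set
T ≡L[ k ] T' = ∀ i → ld T i ≡ ld T' i [mod k ]

_≡R[_]_ : ∀ {n} → Tree n → ℕ → Tree n → Set
T ≡R[ k ] T' = ∀ i → rd T i ≡ rd T' i [mod k ]

-- Number of classes of a relation R on X is m:
-- there are m pairwise R-inequivalent representatives covering X.
-- (For an equivalence relation this says |X / R| = m.)

NumClasses : ∀ {a r} {X : Set a} → (X → X → Set r) → ℕ → Set (a ⊔ r)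
NumClasses {X = X} R m =
  Σ (Fin m → X) λ v →
    (∀ i j → R (v i) (v j) → i ≡ j) × (∀ t → ∃ λ i → R t (v i))

module LinearQuasigroup {c ℓ} (G : Group c ℓ) where
  open Group G

  IsAut : (Carrier → Carrier) → Set (c ⊔ ℓ)
  IsAut φ = GroupMorphisms.IsGroupIsomorphism rawGroup rawGroup φ

  iter : (Carrier → Carrier) → ℕ → Carrier → Carrier
  iter φ zero    a = a
  iter φ (suc j) a = φ (iter φ j a)

  HasOrder : (Carrier → Carrier) → ℕ → Set (c ⊔ ℓ)
  HasOrder φ k =
    0 < k × (∀ a → iter φ k a ≈ a) ×
    (∀ j → 0 < j → j < k → ¬ (∀ a → iter φ j a ≈ a))

  module _ (φ₀ φ₁ : Carrier → Carrier) where
    _∘_ : Carrier → Carrier → Carrier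
    a ∘ b = φ₀ a ∙ φ₁ b

    ⟦_⟧ : ∀ {n} → Bracketing n → (Fin n → Carrier) → Carrier
    ⟦ x ⟧ ρ = ρ Fin.zero
    ⟦ [_·_] {m} {k} t₁ t₂ ⟧ ρ =
      ⟦ t₁ ⟧ (λ i → ρ (i ↑ˡ k)) ∘ ⟦ t₂ ⟧ (λ i → ρ (m ↑ʳ i))

    Satisfies : ∀ {n} → Bracketing n → Bracketing n → Set (c ⊔ ℓ)
    Satisfies t t' = ∀ ρ → ⟦ t ⟧ ρ ≈ ⟦ t' ⟧ ρ

    sₙ≡ : ℕ → ℕ → Set (c ⊔ ℓ)
    sₙ≡ n m = NumClasses (Satisfies {n}) m

-- In each of the three cases both φ₀ and φ₁ are powers φ^b₀, φ^b₁ of one automorphism φ of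
-- order k.  Unfolding a bracketing t then gives the term operation
--   t(x₁,…,xₙ) = φ^{w(1)}(x₁) + ⋯ + φ^{w(n)}(xₙ),
-- where w(i) is the depth of leaf i in τ(t) with left steps weighted b₀ and right steps b₁.
-- Evaluating at tuples with a single nonzero entry shows that t ≈ t' holds iff
-- φ^{w(i)} = φ^{w'(i)} for every i, i.e. iff w(i) ≡ w'(i) (mod k).  The weights (1,1), (1,0)
-- and (0,1) give d, ld and rd, and counting classes transfers along the bijection τ.
module Submission where

open import Defs
open import Data.Nat using (ℕ; zero; suc; _+_; _*_; _∸_; _<_; _≤_; z≤n; s≤s; NonZero; >-nonZero; _%_; _/_)
open import Data.Nat.Properties using (≤-total; m+[n∸m]≡n)
open import Data.Nat.DivMod using (m≡m%n+[m/n]*n; m%n<n)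
open import Data.Nat.Divisibility as ℕ using (divides; m%n≡0⇒n∣m)
open import Data.Fin using (Fin; splitAt; _↑ˡ_; _↑ʳ_)
import Data.Fin as Fin
open import Data.Fin.Properties using (splitAt-↑ˡ; splitAt-↑ʳ; suc-injective)
open import Data.Sum using (inj₁; inj₂)
open import Data.Product using (_×_; _,_; proj₁; proj₂)
open import Data.Integer as ℤ using (+_)
open import Data.Integer.Properties using (∣i-j∣≡∣j-i∣; [+m]-[+n]≡m⊖n; ∣⊖∣-≤)
open import Data.Vec.Functional using (Vector; replicate; updateAt)
open import Data.Vec.Functional.Properties using (updateAt-updates; updateAt-minimal)
open import Data.Empty using (⊥-elim)
open import Relation.Nullary using (¬_)
open import Function using (const)
open import Function.Bundles using (_⇔_; mk⇔; module Equivalence)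
open import Function.Construct.Composition using (_⇔-∘_)
open import Function.Construct.Symmetry using (⇔-sym)
open import Relation.Binary.PropositionalEquality as ≡ using (_≡_; _≢_; cong; cong₂; subst; subst₂)
open import Algebra.Bundles using (Group)
open import Algebra.Morphism.Structures using (module GroupMorphisms)

open Equivalence using (to; from)

fromTree : ∀ {n} → Tree n → Bracketing n
fromTree leaf       = x
fromTree (node l r) = [ fromTree l · fromTree r ]

τ-fromTree : ∀ {n} (T : Tree n) → τ (fromTree T) ≡ T
τ-fromTree leaf       = ≡.refl
τ-fromTree (node l r) = ≡.cong₂ node (τ-fromTree l) (τ-fromTree r)

NumClasses-transport : ∀ {a b r s} {X : Set a} {Y : Set b} (f : X → Y) (g : Y → X) →
  (∀ y → f (g y) ≡ y) → {S : X → X → Set s} {R : Y → Y → Set r} →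
  (∀ u v → S u v ⇔ R (f u) (f v)) → ∀ m → NumClasses S m ⇔ NumClasses R m
NumClasses-transport f g fg {S} {R} S⇔R m = mk⇔ forward backward
  where
  forward : NumClasses S m → NumClasses R m
  forward (v , distinct , cover) =
    (λ i → f (v i)) ,
    (λ i j Rij → distinct i j (from (S⇔R _ _) Rij)) ,
    λ y → let i , S[gy,vi] = cover (g y)
          in i , subst (λ z → R z (f (v i))) (fg y) (to (S⇔R _ _) S[gy,vi])
  backward : NumClasses R m → NumClasses S m
  backward (v , distinct , cover) =
    (λ i → g (v i)) ,
    (λ i j Sij → distinct i j (subst₂ R (fg (v i)) (fg (v j)) (to (S⇔R _ _) Sij))) ,
    λ u → let i , R[fu,vi] = cover (f u)
          in i , from (S⇔R _ _) (subst (R (f u)) (≡.sym (fg (v i))) R[fu,vi])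

weightedDepth : ∀ {n} → ℕ → ℕ → Tree n → Fin n → ℕ
weightedDepth b₀ b₁ leaf i = 0
weightedDepth b₀ b₁ (node {m} l r) i with splitAt m i
... | inj₁ j = b₀ + weightedDepth b₀ b₁ l j
... | inj₂ j = b₁ + weightedDepth b₀ b₁ r j

weightedDepth-↑ˡ : ∀ b₀ b₁ {m n} (l : Tree m) (r : Tree n) (j : Fin m) →
  weightedDepth b₀ b₁ (node l r) (j ↑ˡ n) ≡ b₀ + weightedDepth b₀ b₁ l j
weightedDepth-↑ˡ b₀ b₁ {m} {n} l r j rewrite splitAt-↑ˡ m j n = ≡.refl

weightedDepth-↑ʳ : ∀ b₀ b₁ {m n} (l : Tree m) (r : Tree n) (j : Fin n) →
  weightedDepth b₀ b₁ (node l r) (m ↑ʳ j) ≡ b₁ + weightedDepth b₀ b₁ r j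
weightedDepth-↑ʳ b₀ b₁ {m} {n} l r j rewrite splitAt-↑ʳ m n j = ≡.refl

d≡weightedDepth : ∀ {n} (T : Tree n) i → d T i ≡ weightedDepth 1 1 T i
d≡weightedDepth leaf i = ≡.refl
d≡weightedDepth (node {m} l r) i with splitAt m i
... | inj₁ j = cong suc (d≡weightedDepth l j)
... | inj₂ j = cong suc (d≡weightedDepth r j)

ld≡weightedDepth : ∀ {n} (T : Tree n) i → ld T i ≡ weightedDepth 1 0 T i
ld≡weightedDepth leaf i = ≡.refl
ld≡weightedDepth (node {m} l r) i with splitAt m i
... | inj₁ j = cong suc (ld≡weightedDepth l j)
... | inj₂ j = ld≡weightedDepth r j

rd≡weightedDepth : ∀ {n} (T : Tree n) i → rd T i ≡ weightedDepth 0 1 T i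
rd≡weightedDepth leaf i = ≡.refl
rd≡weightedDepth (node {m} l r) i with splitAt m i
... | inj₁ j = rd≡weightedDepth l j
... | inj₂ j = cong suc (rd≡weightedDepth r j)

≡[mod]-sym : ∀ {a b k} → a ≡ b [mod k ] → b ≡ a [mod k ]
≡[mod]-sym {a} {b} {k} = subst (k ℕ.∣_) (∣i-j∣≡∣j-i∣ (+ a) (+ b))

≡[mod]-resp : ∀ {a a' b b' k} → a ≡ a' → b ≡ b' → a ≡ b [mod k ] → a' ≡ b' [mod k ]
≡[mod]-resp ≡.refl ≡.refl a≡b = a≡b

≡[mod]⇔∣∸ : ∀ {a b k} → b ≤ a → (a ≡ b [mod k ]) ⇔ (k ℕ.∣ a ∸ b)
≡[mod]⇔∣∸ {a} {b} {k} b≤a =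
  mk⇔ (subst (k ℕ.∣_) ∣a-b∣≡a∸b) (subst (k ℕ.∣_) (≡.sym ∣a-b∣≡a∸b))
  where
  open ≡.≡-Reasoning
  ∣a-b∣≡a∸b : ℤ.∣ + a ℤ.- + b ∣ ≡ a ∸ b
  ∣a-b∣≡a∸b = begin
    ℤ.∣ + a ℤ.- + b ∣ ≡⟨ ∣i-j∣≡∣j-i∣ (+ a) (+ b) ⟩
    ℤ.∣ + b ℤ.- + a ∣ ≡⟨ cong ℤ.∣_∣ ([+m]-[+n]≡m⊖n b a) ⟩
    ℤ.∣ b ℤ.⊖ a ∣     ≡⟨ ∣⊖∣-≤ b≤a ⟩
    a ∸ b             ∎

module _ {c ℓ} (G : Group c ℓ) where
  open Group G
  open LinearQuasigroup G
  open import Algebra.Properties.Monoid.Sum monoid using (sum; sum-cong-≋; sum-cong-≗; sum-replicate-zero)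
  open import Relation.Binary.Reasoning.Setoid setoid

  sum-++ : ∀ m n (f : Vector Carrier (m + n)) →
    sum f ≈ sum (λ i → f (i ↑ˡ n)) ∙ sum (λ j → f (m ↑ʳ j))
  sum-++ zero    n f = sym (identityˡ _)
  sum-++ (suc m) n f = trans (∙-congˡ (sum-++ m n (λ i → f (Fin.suc i)))) (sym (assoc _ _ _))

  sum-ε : ∀ {n} (f : Vector Carrier n) → (∀ i → f i ≈ ε) → sum f ≈ ε
  sum-ε {n} f f≈ε = trans (sum-cong-≋ f≈ε) (sum-replicate-zero n)

  sum-single : ∀ {n} (f : Vector Carrier n) i → (∀ j → j ≢ i → f j ≈ ε) → sum f ≈ f i
  sum-single f Fin.zero    f≈ε =
    trans (∙-congˡ (sum-ε _ (λ j → f≈ε (Fin.suc j) λ ()))) (identityʳ _)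
  sum-single f (Fin.suc i) f≈ε =
    trans (∙-congʳ (f≈ε Fin.zero λ ()))
      (trans (identityˡ _) (sum-single _ i (λ j j≢i → f≈ε (Fin.suc j) (λ e → j≢i (suc-injective e)))))

  iter-+ : ∀ (φ : Carrier → Carrier) m n a → iter φ (m + n) a ≡ iter φ m (iter φ n a)
  iter-+ φ zero    n a = ≡.refl
  iter-+ φ (suc m) n a = cong φ (iter-+ φ m n a)

  module Automorphism (φ : Carrier → Carrier) (aut : IsAut φ) where
    open GroupMorphisms.IsGroupIsomorphism aut using (⟦⟧-cong; ε-homo; ∙-homo; injective)

    iter-cong : ∀ j {a b} → a ≈ b → iter φ j a ≈ iter φ j b
    iter-cong zero    a≈b = a≈b
    iter-cong (suc j) a≈b = ⟦⟧-cong (iter-cong j a≈b)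

    iter-injective : ∀ j {a b} → iter φ j a ≈ iter φ j b → a ≈ b
    iter-injective zero    e = e
    iter-injective (suc j) e = iter-injective j (injective e)

    iter-ε : ∀ j → iter φ j ε ≈ ε
    iter-ε zero    = refl
    iter-ε (suc j) = trans (⟦⟧-cong (iter-ε j)) ε-homo

    iter-∙ : ∀ j a b → iter φ j (a ∙ b) ≈ iter φ j a ∙ iter φ j b
    iter-∙ zero    a b = refl
    iter-∙ (suc j) a b = trans (⟦⟧-cong (iter-∙ j a b)) (∙-homo _ _)

    iter-sum : ∀ j {n} (f : Vector Carrier n) → iter φ j (sum f) ≈ sum (λ i → iter φ j (f i))
    iter-sum j {zero}  f = iter-ε j
    iter-sum j {suc n} f = trans (iter-∙ j _ _) (∙-congˡ (iter-sum j (λ i → f (Fin.suc i))))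

    iter-shift⇔ : ∀ b c → (∀ a → iter φ (b + c) a ≈ iter φ b a) ⇔ (∀ a → iter φ c a ≈ a)
    iter-shift⇔ b c = mk⇔
      (λ h a → iter-injective b (trans (reflexive (≡.sym (iter-+ φ b c a))) (h a)))
      (λ h a → trans (reflexive (iter-+ φ b c a)) (iter-cong b (h a)))

    module Order {k} (ord : HasOrder φ k) where
      private
        iter-k≈id : ∀ a → iter φ k a ≈ a
        iter-k≈id = proj₁ (proj₂ ord)
        minimal : ∀ j → 0 < j → j < k → ¬ (∀ a → iter φ j a ≈ a)
        minimal = proj₂ (proj₂ ord)
        instance
          k≢0 : NonZero k
          k≢0 = >-nonZero (proj₁ ord)

      iter-multiple : ∀ q a → iter φ (q * k) a ≈ a
      iter-multiple zero    a = refl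
      iter-multiple (suc q) a = begin
        iter φ (k + q * k) a        ≡⟨ iter-+ φ k (q * k) a ⟩
        iter φ k (iter φ (q * k) a) ≈⟨ iter-k≈id (iter φ (q * k) a) ⟩
        iter φ (q * k) a            ≈⟨ iter-multiple q a ⟩
        a                           ∎

      fixes-all⇒≡0 : ∀ {r} → r < k → (∀ a → iter φ r a ≈ a) → r ≡ 0
      fixes-all⇒≡0 {zero}  _   _ = ≡.refl
      fixes-all⇒≡0 {suc r} r<k h = ⊥-elim (minimal (suc r) (s≤s z≤n) r<k h)

      fixes-all-% : ∀ {c} → (∀ a → iter φ c a ≈ a) → ∀ a → iter φ (c % k) a ≈ a
      fixes-all-% {c} h a = begin
        iter φ (c % k) a                          ≈⟨ iter-cong (c % k) (iter-multiple (c / k) a) ⟨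
        iter φ (c % k) (iter φ (c / k * k) a)     ≡⟨ iter-+ φ (c % k) (c / k * k) a ⟨
        iter φ (c % k + c / k * k) a              ≡⟨ cong (λ e → iter φ e a) (m≡m%n+[m/n]*n c k) ⟨
        iter φ c a                                ≈⟨ h a ⟩
        a                                         ∎

      fixes-all⇔∣ : ∀ c → (∀ a → iter φ c a ≈ a) ⇔ (k ℕ.∣ c)
      fixes-all⇔∣ c = mk⇔
        (λ h → m%n≡0⇒n∣m c k (fixes-all⇒≡0 (m%n<n c k) (fixes-all-% h)))
        (λ { (divides q ≡.refl) → iter-multiple q })

      iter≈⇔≡[mod]-≥ : ∀ {a b} → b ≤ a → (∀ u → iter φ a u ≈ iter φ b u) ⇔ (a ≡ b [mod k ])
      iter≈⇔≡[mod]-≥ {a} {b} b≤a =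
        subst (λ e → (∀ u → iter φ e u ≈ iter φ b u) ⇔ (a ≡ b [mod k ])) (m+[n∸m]≡n b≤a)
          (⇔-sym (≡[mod]⇔∣∸ b≤a) ⇔-∘ (fixes-all⇔∣ (a ∸ b) ⇔-∘ iter-shift⇔ b (a ∸ b)))

      iter≈⇔≡[mod] : ∀ a b → (∀ u → iter φ a u ≈ iter φ b u) ⇔ (a ≡ b [mod k ])
      iter≈⇔≡[mod] a b with ≤-total b a
      ... | inj₁ b≤a = iter≈⇔≡[mod]-≥ b≤a
      ... | inj₂ a≤b = mk⇔
        (λ h → ≡[mod]-sym {b} {a} (to (iter≈⇔≡[mod]-≥ a≤b) (λ u → sym (h u))))
        (λ a≡b u → sym (from (iter≈⇔≡[mod]-≥ a≤b) (≡[mod]-sym {a} {b} a≡b) u))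

    module PowerQuasigroup {φ₀ φ₁ : Carrier → Carrier} {b₀ b₁ : ℕ}
      (φ₀≈ : ∀ a → φ₀ a ≈ iter φ b₀ a) (φ₁≈ : ∀ a → φ₁ a ≈ iter φ b₁ a) where

      monomials : ∀ {n} → Tree n → Vector Carrier n → Vector Carrier n
      monomials T ρ i = iter φ (weightedDepth b₀ b₁ T i) (ρ i)

      ⟦⟧≈sum-monomials : ∀ {n} (t : Bracketing n) ρ → ⟦_⟧ φ₀ φ₁ t ρ ≈ sum (monomials (τ t) ρ)
      ⟦⟧≈sum-monomials x ρ = sym (identityʳ _)
      ⟦⟧≈sum-monomials ([_·_] {m} {n} t₁ t₂) ρ = begin
        φ₀ (⟦_⟧ φ₀ φ₁ t₁ ρ₁) ∙ φ₁ (⟦_⟧ φ₀ φ₁ t₂ ρ₂)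
          ≈⟨ ∙-cong (trans (φ₀≈ _) (iter-cong b₀ (⟦⟧≈sum-monomials t₁ ρ₁)))
                    (trans (φ₁≈ _) (iter-cong b₁ (⟦⟧≈sum-monomials t₂ ρ₂))) ⟩
        iter φ b₀ (sum (monomials T₁ ρ₁)) ∙ iter φ b₁ (sum (monomials T₂ ρ₂))
          ≈⟨ ∙-cong (iter-sum b₀ (monomials T₁ ρ₁)) (iter-sum b₁ (monomials T₂ ρ₂)) ⟩
        sum (λ i → iter φ b₀ (monomials T₁ ρ₁ i)) ∙ sum (λ j → iter φ b₁ (monomials T₂ ρ₂ j))
          ≡⟨ cong₂ _∙_ (sum-cong-≗ left) (sum-cong-≗ right) ⟩
        sum (λ i → monomials T ρ (i ↑ˡ n)) ∙ sum (λ j → monomials T ρ (m ↑ʳ j))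
          ≈⟨ sum-++ m n (monomials T ρ) ⟨
        sum (monomials T ρ) ∎
        where
        T₁ : Tree m
        T₁ = τ t₁
        T₂ : Tree n
        T₂ = τ t₂
        T : Tree (m + n)
        T = node T₁ T₂
        ρ₁ : Vector Carrier m
        ρ₁ i = ρ (i ↑ˡ n)
        ρ₂ : Vector Carrier n
        ρ₂ j = ρ (m ↑ʳ j)
        left : ∀ i → iter φ b₀ (monomials T₁ ρ₁ i) ≡ monomials T ρ (i ↑ˡ n)
        left i = ≡.trans (≡.sym (iter-+ φ b₀ _ _))
                         (cong (λ e → iter φ e (ρ₁ i)) (≡.sym (weightedDepth-↑ˡ b₀ b₁ T₁ T₂ i)))
        right : ∀ j → iter φ b₁ (monomials T₂ ρ₂ j) ≡ monomials T ρ (m ↑ʳ j)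
        right j = ≡.trans (≡.sym (iter-+ φ b₁ _ _))
                          (cong (λ e → iter φ e (ρ₂ j)) (≡.sym (weightedDepth-↑ʳ b₀ b₁ T₁ T₂ j)))

      single : ∀ {n} → Fin n → Carrier → Vector Carrier n
      single {n} i a = updateAt (replicate n ε) i (const a)

      ⟦⟧-single : ∀ {n} (t : Bracketing n) i a →
        ⟦_⟧ φ₀ φ₁ t (single i a) ≈ iter φ (weightedDepth b₀ b₁ (τ t) i) a
      ⟦⟧-single {n} t i a = begin
        ⟦_⟧ φ₀ φ₁ t (single i a)
          ≈⟨ ⟦⟧≈sum-monomials t (single i a) ⟩
        sum (monomials (τ t) (single i a))
          ≈⟨ sum-single (monomials (τ t) (single i a)) i vanishes ⟩
        monomials (τ t) (single i a) i
          ≡⟨ cong (iter φ (w i)) (updateAt-updates i (replicate n ε)) ⟩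
        iter φ (w i) a ∎
        where
        w : Fin n → ℕ
        w = weightedDepth b₀ b₁ (τ t)
        vanishes : ∀ j → j ≢ i → monomials (τ t) (single i a) j ≈ ε
        vanishes j j≢i =
          trans (reflexive (cong (iter φ (w j)) (updateAt-minimal j i (replicate n ε) j≢i))) (iter-ε (w j))

      module _ {k} (ord : HasOrder φ k) where
        open Order ord

        satisfies⇔depths≡[mod] : ∀ {n} (t t' : Bracketing n) →
          Satisfies φ₀ φ₁ t t' ⇔
            (∀ i → weightedDepth b₀ b₁ (τ t) i ≡ weightedDepth b₀ b₁ (τ t') i [mod k ])
        satisfies⇔depths≡[mod] {n} t t' = mk⇔
          (λ t≈t' i → to (iter≈⇔≡[mod] (w t i) (w t' i)) λ a →
            trans (sym (⟦⟧-single t i a)) (trans (t≈t' (single i a)) (⟦⟧-single t' i a)))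
          (λ w≡w' ρ → begin
            ⟦_⟧ φ₀ φ₁ t ρ            ≈⟨ ⟦⟧≈sum-monomials t ρ ⟩
            sum (monomials (τ t) ρ)
              ≈⟨ sum-cong-≋ (λ i → from (iter≈⇔≡[mod] (w t i) (w t' i)) (w≡w' i) (ρ i)) ⟩
            sum (monomials (τ t') ρ) ≈⟨ ⟦⟧≈sum-monomials t' ρ ⟨
            ⟦_⟧ φ₀ φ₁ t' ρ           ∎)
          where
          w : Bracketing n → Fin n → ℕ
          w s = weightedDepth b₀ b₁ (τ s)

        identities⇔depths≡[mod] : (D : ∀ {n} → Tree n → Fin n → ℕ) →
          (∀ {n} (T : Tree n) i → D T i ≡ weightedDepth b₀ b₁ T i) → ∀ n →
          (∀ (t t' : Bracketing n) → Satisfies φ₀ φ₁ t t' ⇔ (∀ i → D (τ t) i ≡ D (τ t') i [mod k ]))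
          × (∀ m → sₙ≡ φ₀ φ₁ n m ⇔ NumClasses (λ (T T' : Tree n) → ∀ i → D T i ≡ D T' i [mod k ]) m)
        identities⇔depths≡[mod] D D≡w n =
          satisfies⇔D , NumClasses-transport τ fromTree τ-fromTree {R = D-congruent} satisfies⇔D
          where
          D-congruent : Tree n → Tree n → Set
          D-congruent T T' = ∀ i → D T i ≡ D T' i [mod k ]
          satisfies⇔D : ∀ (t t' : Bracketing n) → Satisfies φ₀ φ₁ t t' ⇔ D-congruent (τ t) (τ t')
          satisfies⇔D t t' = mk⇔
            (λ t≈t' i → ≡[mod]-resp (≡.sym (D≡w (τ t) i)) (≡.sym (D≡w (τ t') i))
                                     (to (satisfies⇔depths≡[mod] t t') t≈t' i))
            (λ D≡D' → from (satisfies⇔depths≡[mod] t t') λ i →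
                        ≡[mod]-resp (D≡w (τ t) i) (D≡w (τ t') i) (D≡D' i))

proposition4p5 : ∀ {c ℓ} (G : Group c ℓ) →
    let open Group G in
    let open LinearQuasigroup G in
    (φ₀ φ₁ : Carrier → Carrier) → IsAut φ₀ → IsAut φ₁ →
    (n k : ℕ) →
      ( ((∀ a → φ₀ a ≈ φ₁ a) → HasOrder φ₀ k →
          (∀ (t t' : Bracketing n) →
             Satisfies φ₀ φ₁ t t' ⇔ (τ t ≡D[ k ] τ t'))
          × (∀ m → sₙ≡ φ₀ φ₁ n m ⇔ NumClasses (λ (T T' : Tree n) → T ≡D[ k ] T') m))
      × ((∀ a → φ₁ a ≈ a) → HasOrder φ₀ k →
          (∀ (t t' : Bracketing n) →
             Satisfies φ₀ φ₁ t t' ⇔ (τ t ≡L[ k ] τ t'))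
          × (∀ m → sₙ≡ φ₀ φ₁ n m ⇔ NumClasses (λ (T T' : Tree n) → T ≡L[ k ] T') m))
      × ((∀ a → φ₀ a ≈ a) → HasOrder φ₁ k →
          (∀ (t t' : Bracketing n) →
             Satisfies φ₀ φ₁ t t' ⇔ (τ t ≡R[ k ] τ t'))
          × (∀ m → sₙ≡ φ₀ φ₁ n m ⇔ NumClasses (λ (T T' : Tree n) → T ≡R[ k ] T') m)) )
proposition4p5 G φ₀ φ₁ aut₀ aut₁ n k =
  (λ φ₀≈φ₁ ord → Aut₀.PowerQuasigroup.identities⇔depths≡[mod] (λ _ → refl) (λ a → sym (φ₀≈φ₁ a))
                   ord d d≡weightedDepth n) ,
  (λ φ₁≈id ord → Aut₀.PowerQuasigroup.identities⇔depths≡[mod] (λ _ → refl) φ₁≈id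
                   ord ld ld≡weightedDepth n) ,
  (λ φ₀≈id ord → Aut₁.PowerQuasigroup.identities⇔depths≡[mod] φ₀≈id (λ _ → refl)
                   ord rd rd≡weightedDepth n)
  where
  open Group G using (refl; sym)
  module Aut₀ = Automorphism G φ₀ aut₀
  module Aut₁ = Automorphism G φ₁ aut₁
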